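{- Let $p>3$ be a prime and let $t = (2p+1)/3$ if $p \equiv 1 \pmod 3$ and $t = (p+1)/3$ if $p \equiv 2 \pmod 3$. Then each rational number \[\frac{(p+t-1)!\,(r+1)!}{(r+t+1)!}, \qquad 1 \leq r \leq p-1,\] has denominator prime to $p$, and in $\mathbb{F}_p$ \[\sum_{r=1}^{p-1} \frac{(p+t-1)!}{(r+t+1)!}(r+1)! = 0.\]
   Context: Here $t$ is an integer representative of the inverse of $3$ modulo $p$. The sum is a rational number with denominator prime to $p$, and the equality means its reduction modulo $p$ is $0$. -}

module Defs where

open import Data.Nat using (ℕ; zero; suc; _+_; _*_; _∸_)
open import Data.Nat.DivMod using (_/_; _%_)
open import Data.Nat.Properties using (_≟_)
open import Data.Nat.Combinatorics using ()
open import Data.Nat.Base using (_!)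
open import Data.Nat.Properties using (_!≢0)
open import Data.Nat.Divisibility using (_∣_)
open import Data.Integer using (+_; ∣_∣)
open import Data.Rational using (ℚ; ↥_; ↧ₙ_; 0ℚ) renaming (_/_ to _/ℚ_; _+_ to _+ℚ_)
open import Data.Product using (_×_)
open import Relation.Nullary using (¬_; does)
open import Data.Bool using (if_then_else_)

tOf : ℕ → ℕ
tOf p = if does (p % 3 ≟ 1) then (2 * p + 1) / 3 else (p + 1) / 3

term : ℕ → ℕ → ℕ → ℚ
term p t r = (+ ((p + t ∸ 1) ! * (suc r) !) /ℚ (r + t + 1) !) {{(r + t + 1) !≢0}}

sumFrom1 : (ℕ → ℚ) → ℕ → ℚ
sumFrom1 f zero = 0ℚ
sumFrom1 f (suc n) = sumFrom1 f n +ℚ f (suc n)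

DenomPrimeTo : ℕ → ℚ → Set
DenomPrimeTo p q = ¬ (p ∣ ↧ₙ q)

-- a rational q with denominator prime to p reduces to 0 in F_p:
-- the denominator is prime to p and p divides the numerator (lowest terms)
IsZeroModP : ℕ → ℚ → Set
IsZeroModP p q = DenomPrimeTo p q × (p ∣ ∣ ↥ q ∣)

{-# OPTIONS --safe #-}

-- With F = (p+t-1)! and t ≥ 2, the identity
--   (t-1) (r+1)!/(r+t+1)! = (r+1)!/(r+t)! - (r+2)!/(r+t+1)!
-- makes the sum telescope:
--   Σ_{r=1}^{n} F (r+1)!/(r+t+1)! = F (2/(t+1)! - (n+2)!/(n+t+1)!) / (t-1).
-- For n = p-1 this is (2F/(t+1)! - (p+1)!/(p+t)) / (t-1), whose numerator is divisible by p
-- (p ≤ p+t-1 and p ≤ p+1) and whose denominator (t-1)(t+1)!(p+t) is prime to p as soon as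
-- 2 ≤ t ≤ p-2; the given t satisfies this. Likewise every single term is an integer,
-- except the last one, which is p!/(p+t).
module Submission where

open import Defs
open import Data.Nat using (ℕ; _<_; _≤_; _∸_)
open import Data.Nat.Primality using (Prime)
open import Data.Product using (_×_)

open import Data.Nat as ℕ using (zero; suc; _+_; NonZero; _!; s≤s; z≤n)
import Data.Nat.Properties as ℕP
open ℕP using (_!≢0)
open import Data.Nat.Divisibility
open import Data.Nat.Primality
  using (euclidsLemma; prime⇒nonTrivial; prime⇒irreducible; composite⇒¬prime; composite[4])
import Data.Nat.Coprimality as Coprime
open import Data.Nat.DivMod using (_%_; _/_; m≡m%n+[m/n]*n; m%n<n; m*n/n≡m)
import Data.Nat.Tactic.RingSolver as ℕ-Solver
open import Data.Integer as ℤ using (ℤ; +_; ∣_∣)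
import Data.Integer.Properties as ℤP
open import Data.Integer.GCD using (gcd)
open import Data.Integer.Tactic.RingSolver using (solve-∀)
open import Algebra.Properties.CommutativeSemigroup ℤP.*-commutativeSemigroup using (xy∙z≈xz∙y; x∙yz≈xz∙y)
open import Data.Rational as ℚ using (mkℚ; toℚᵘ; ↥_; ↧_; ↧ₙ_)
import Data.Rational.Properties as ℚP
open import Data.Rational.Unnormalised as ℚᵘ using (ℚᵘ; mkℚᵘ; *≡*) renaming (_≃_ to _≃ᵘ_)
open import Data.Product using (∃; _,_; proj₂)
open import Data.Sum using (inj₁; inj₂; [_,_]′)
open import Data.Empty using (⊥-elim)
open import Function using (id; _∘_)
open import Relation.Binary.PropositionalEquality
open ≡-Reasoning

infix 4 _≈_÷_

-- x = N / D with the denominators cleared (so D = 0 is allowed); a record, so that N and D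
-- can be inferred from the type.
record _≈_÷_ (x : ℚᵘ) (N D : ℤ) : Set where
  constructor cross
  field
    cross-eq : ℚᵘ.↥ x ℤ.* D ≡ N ℤ.* ℚᵘ.↧ x

≈-rescale : ∀ x {N D N′ D′} .{{_ : ℤ.NonZero D}} →
            x ≈ N ÷ D → N ℤ.* D′ ≡ N′ ℤ.* D → x ≈ N′ ÷ D′
≈-rescale x {N} {D} {N′} {D′} (cross x≈N÷D) N*D′≡N′*D = cross (ℤP.*-cancelʳ-≡ _ _ D (begin
  ↥x ℤ.* D′ ℤ.* D  ≡⟨ xy∙z≈xz∙y ↥x D′ D ⟩
  ↥x ℤ.* D ℤ.* D′  ≡⟨ cong (ℤ._* D′) x≈N÷D ⟩
  N ℤ.* ↧x ℤ.* D′  ≡⟨ xy∙z≈xz∙y N ↧x D′ ⟩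
  N ℤ.* D′ ℤ.* ↧x  ≡⟨ cong (ℤ._* ↧x) N*D′≡N′*D ⟩
  N′ ℤ.* D ℤ.* ↧x  ≡⟨ xy∙z≈xz∙y N′ D ↧x ⟩
  N′ ℤ.* ↧x ℤ.* D  ∎))
  where
  ↥x = ℚᵘ.↥ x
  ↧x = ℚᵘ.↧ x

≈-rescaleℕ : ∀ x {N D N′ D′} .{{_ : NonZero D}} →
             x ≈ + N ÷ + D → N ℕ.* D′ ≡ N′ ℕ.* D → x ≈ + N′ ÷ + D′
≈-rescaleℕ x {N} {D} {N′} {D′} x≈N÷D N*D′≡N′*D = ≈-rescale x x≈N÷D (begin
  + N ℤ.* + D′   ≡⟨ ℤP.pos-* N D′ ⟨
  + (N ℕ.* D′)   ≡⟨ cong +_ N*D′≡N′*D ⟩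
  + (N′ ℕ.* D)   ≡⟨ ℤP.pos-* N′ D ⟩
  + N′ ℤ.* + D   ∎)

≃ᵘ-≈ : ∀ {x y N D} → x ≃ᵘ y → y ≈ N ÷ D → x ≈ N ÷ D
≃ᵘ-≈ {x} {y} (*≡* x≃y) (cross y≈N÷D) = ≈-rescale x (cross {N = ℚᵘ.↥ y} {ℚᵘ.↧ y} x≃y) y≈N÷D

+-≈ : ∀ x y {N M D E} → x ≈ N ÷ D → y ≈ M ÷ E →
      x ℚᵘ.+ y ≈ N ℤ.* E ℤ.+ M ℤ.* D ÷ D ℤ.* E
+-≈ (mkℚᵘ a b-1) (mkℚᵘ c d-1) {N} {M} {D} {E} (cross x≈N÷D) (cross y≈M÷E) = cross (begin
  (a ℤ.* d ℤ.+ c ℤ.* b) ℤ.* (D ℤ.* E)          ≡⟨ expand a c b d D E ⟩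
  a ℤ.* D ℤ.* (d ℤ.* E) ℤ.+ c ℤ.* E ℤ.* (b ℤ.* D)
    ≡⟨ cong₂ (λ u v → u ℤ.* (d ℤ.* E) ℤ.+ v ℤ.* (b ℤ.* D)) x≈N÷D y≈M÷E ⟩
  N ℤ.* b ℤ.* (d ℤ.* E) ℤ.+ M ℤ.* d ℤ.* (b ℤ.* D) ≡⟨ collect N M b d D E ⟩
  (N ℤ.* E ℤ.+ M ℤ.* D) ℤ.* (b ℤ.* d)          ∎)
  where
  b = + suc b-1
  d = + suc d-1
  expand : ∀ a c b d D E → (a ℤ.* d ℤ.+ c ℤ.* b) ℤ.* (D ℤ.* E)
                         ≡ a ℤ.* D ℤ.* (d ℤ.* E) ℤ.+ c ℤ.* E ℤ.* (b ℤ.* D)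
  expand = solve-∀
  collect : ∀ N M b d D E → N ℤ.* b ℤ.* (d ℤ.* E) ℤ.+ M ℤ.* d ℤ.* (b ℤ.* D)
                          ≡ (N ℤ.* E ℤ.+ M ℤ.* D) ℤ.* (b ℤ.* d)
  collect = solve-∀

toℚᵘ-≈ : ∀ q {N D} → ↥ q ℤ.* D ≡ N ℤ.* ↧ q → toℚᵘ q ≈ N ÷ D
toℚᵘ-≈ (mkℚ _ _ _) eq = cross eq

toℚᵘ-/-≈ : ∀ i n .{{_ : NonZero n}} → toℚᵘ (i ℚ./ n) ≈ i ÷ + n
toℚᵘ-/-≈ i n = toℚᵘ-≈ q (begin
  ↥ q ℤ.* + n          ≡⟨ cong (↥ q ℤ.*_) (ℚP.↧-/ i n) ⟨
  ↥ q ℤ.* (↧ q ℤ.* g)  ≡⟨ x∙yz≈xz∙y (↥ q) (↧ q) g ⟩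
  ↥ q ℤ.* g ℤ.* ↧ q    ≡⟨ cong (ℤ._* ↧ q) (ℚP.↥-/ i n) ⟩
  i ℤ.* ↧ q            ∎)
  where
  q = i ℚ./ n
  g = gcd i (+ n)

≈⇒∣↥∣*≡∣N∣*↧ₙ : ∀ q {N D} → toℚᵘ q ≈ N ÷ + D → ∣ ↥ q ∣ ℕ.* D ≡ ∣ N ∣ ℕ.* ↧ₙ q
≈⇒∣↥∣*≡∣N∣*↧ₙ (mkℚ n d-1 _) {N} {D} (cross q≈N÷D) = begin
  ∣ n ∣ ℕ.* D              ≡⟨ ℤP.abs-* n (+ D) ⟨
  ∣ n ℤ.* + D ∣            ≡⟨ cong ∣_∣ q≈N÷D ⟩
  ∣ N ℤ.* + suc d-1 ∣      ≡⟨ ℤP.abs-* N (+ suc d-1) ⟩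
  ∣ N ∣ ℕ.* suc d-1        ∎

≈⇒↧ₙ∣ : ∀ q {N D} → toℚᵘ q ≈ N ÷ + D → ↧ₙ q ∣ D
≈⇒↧ₙ∣ q@(mkℚ _ _ coprime) {N} q≈N÷D =
  Coprime.coprime-divisor (Coprime.sym (Coprime.recompute coprime))
                          (divides ∣ N ∣ (≈⇒∣↥∣*≡∣N∣*↧ₙ q q≈N÷D))

≈⇒denomPrimeTo : ∀ {p q N D} → p ∤ D → toℚᵘ q ≈ N ÷ + D → DenomPrimeTo p q
≈⇒denomPrimeTo {q = q} p∤D q≈N÷D p∣↧ₙq = p∤D (∣-trans p∣↧ₙq (≈⇒↧ₙ∣ q q≈N÷D))

≈⇒isZeroModP : ∀ {p q N D} → Prime p → p ∤ D → p ∣ ∣ N ∣ →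
               toℚᵘ q ≈ N ÷ + D → IsZeroModP p q
≈⇒isZeroModP {p} {q} {N} {D} p-prime p∤D p∣N q≈N÷D =
  ≈⇒denomPrimeTo p∤D q≈N÷D , [ id , ⊥-elim ∘ p∤D ]′ (euclidsLemma ∣ ↥ q ∣ D p-prime p∣∣↥q∣*D)
  where
  p∣∣↥q∣*D : p ∣ ∣ ↥ q ∣ ℕ.* D
  p∣∣↥q∣*D = subst (p ∣_) (sym (≈⇒∣↥∣*≡∣N∣*↧ₙ q q≈N÷D)) (∣-trans p∣N (m∣m*n (↧ₙ q)))

m≤n⇒m∣n!  : ∀ {m n} .{{_ : NonZero m}} → m ≤ n → m ∣ n !
m≤n⇒m∣n! {suc m} m≤n = ∣-trans (m∣m*n (m !)) (m≤n⇒m!∣n! m≤n)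

prime∤* : ∀ {p m n} → Prime p → p ∤ m → p ∤ n → p ∤ m ℕ.* n
prime∤* p-prime p∤m p∤n p∣m*n = [ p∤m , p∤n ]′ (euclidsLemma _ _ p-prime p∣m*n)

prime∤! : ∀ {p n} → Prime p → n < p → p ∤ n !
prime∤! {p} {zero} p-prime _ = >⇒∤ (ℕ.nonTrivial⇒n>1 p {{prime⇒nonTrivial p-prime}})
prime∤! {n = suc n} p-prime n<p =
  prime∤* p-prime (>⇒∤ n<p) (prime∤! p-prime (ℕP.<-trans (ℕP.n<1+n n) n<p))

∣-linear : ∀ {p x y} i j → p ∣ x → p ∣ y → p ∣ ∣ i ℤ.* + x ℤ.- + y ℤ.* j ∣
∣-linear {p} i j (divides a refl) (divides b refl) = divides ∣ k ∣ (begin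
  ∣ i ℤ.* + (a ℕ.* p) ℤ.- + (b ℕ.* p) ℤ.* j ∣
    ≡⟨ cong₂ (λ u v → ∣ i ℤ.* u ℤ.- v ℤ.* j ∣) (ℤP.pos-* a p) (ℤP.pos-* b p) ⟩
  ∣ i ℤ.* (+ a ℤ.* + p) ℤ.- + b ℤ.* + p ℤ.* j ∣ ≡⟨ cong ∣_∣ (factor i (+ a) (+ b) j (+ p)) ⟩
  ∣ k ℤ.* + p ∣                                 ≡⟨ ℤP.abs-* k (+ p) ⟩
  ∣ k ∣ ℕ.* p                                   ∎)
  where
  k = i ℤ.* + a ℤ.- + b ℤ.* j
  factor : ∀ i a b j p → i ℤ.* (a ℤ.* p) ℤ.- b ℤ.* p ℤ.* j ≡ (i ℤ.* a ℤ.- b ℤ.* j) ℤ.* p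
  factor = solve-∀

-- X′ = X (n+1) and Y′ = Y (n+1), where the factorials X n = (n+t+1)! and Y n = (n+2)! grow
-- by the factors n+t+2 = C + K and K = n+3, with C = t-1.
telescoping-step : ∀ F X Y A C K {X′ Y′ FY} →
  X′ ≡ (C ℤ.+ K) ℤ.* X → Y′ ≡ K ℤ.* Y → FY ≡ F ℤ.* Y →
  (F ℤ.* (+ 2 ℤ.* X ℤ.- Y ℤ.* A) ℤ.* X′ ℤ.+ FY ℤ.* (C ℤ.* (A ℤ.* X))) ℤ.* (C ℤ.* (A ℤ.* X′))
  ≡ F ℤ.* (+ 2 ℤ.* X′ ℤ.- Y′ ℤ.* A) ℤ.* (C ℤ.* (A ℤ.* X) ℤ.* X′)
telescoping-step F X Y A C K refl refl refl = identity F X Y A C K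
  where
  identity : ∀ F X Y A C K →
    (F ℤ.* (+ 2 ℤ.* X ℤ.- Y ℤ.* A) ℤ.* ((C ℤ.+ K) ℤ.* X) ℤ.+ F ℤ.* Y ℤ.* (C ℤ.* (A ℤ.* X)))
      ℤ.* (C ℤ.* (A ℤ.* ((C ℤ.+ K) ℤ.* X)))
    ≡ F ℤ.* (+ 2 ℤ.* ((C ℤ.+ K) ℤ.* X) ℤ.- K ℤ.* Y ℤ.* A)
        ℤ.* (C ℤ.* (A ℤ.* X) ℤ.* ((C ℤ.+ K) ℤ.* X))
  identity = solve-∀

module Telescoping (p c : ℕ) where

  t : ℕ
  t = 2 + c

  F : ℕ
  F = (p + t ∸ 1) !

  X : ℕ → ℕ
  X n = (n + t + 1) !

  Y : ℕ → ℕ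
  Y n = (2 + n) !

  A : ℕ
  A = X 0

  numerator : ℕ → ℤ
  numerator n = + F ℤ.* (+ 2 ℤ.* + X n ℤ.- + Y n ℤ.* + A)

  denominator : ℕ → ℤ
  denominator n = + (1 + c) ℤ.* (+ A ℤ.* + X n)

  X-nonZero : ∀ n → ℤ.NonZero (+ X n)
  X-nonZero n = (n + t + 1) !≢0

  denominator-nonZero : ∀ n → ℤ.NonZero (denominator n)
  denominator-nonZero n =
    ℤP.i*j≢0 (+ (1 + c)) (+ A ℤ.* + X n) {{_}} {{A*X≢0}}
    where
    A*X≢0 = ℤP.i*j≢0 (+ A) (+ X n) {{X-nonZero 0}} {{X-nonZero n}}

  X-suc : ∀ n → + X (suc n) ≡ (+ (1 + c) ℤ.+ + (3 + n)) ℤ.* + X n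
  X-suc n = begin
    + X (suc n)                        ≡⟨ ℤP.pos-* (suc (n + t + 1)) (X n) ⟩
    + suc (n + t + 1) ℤ.* + X n        ≡⟨ cong (λ m → + m ℤ.* + X n) (split n c) ⟩
    + (1 + c + (3 + n)) ℤ.* + X n      ≡⟨ cong (ℤ._* + X n) (ℤP.pos-+ (1 + c) (3 + n)) ⟩
    (+ (1 + c) ℤ.+ + (3 + n)) ℤ.* + X n ∎
    where
    split : ∀ n c → suc (n + (2 + c) + 1) ≡ 1 + c + (3 + n)
    split = ℕ-Solver.solve-∀

  closedForm : ∀ n → toℚᵘ (sumFrom1 (term p t) n) ≈ numerator n ÷ denominator n
  closedForm zero = cross (vanish (+ F) (+ A) (denominator 0))
    where
    vanish : ∀ F A D → + 0 ℤ.* D ≡ F ℤ.* (+ 2 ℤ.* A ℤ.- + 2 ℤ.* A) ℤ.* + 1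
    vanish = solve-∀
  closedForm (suc n) = ≈-rescale _ {{D*X≢0}} sum≈ step
    where
    S = sumFrom1 (term p t) n
    D*X≢0 = ℤP.i*j≢0 (denominator n) (+ X (suc n)) {{denominator-nonZero n}} {{X-nonZero (suc n)}}
    sum≈ : toℚᵘ (S ℚ.+ term p t (suc n))
           ≈ numerator n ℤ.* + X (suc n) ℤ.+ + (F ℕ.* Y n) ℤ.* denominator n
           ÷ denominator n ℤ.* + X (suc n)
    sum≈ = ≃ᵘ-≈ (ℚP.toℚᵘ-homo-+ S (term p t (suc n)))
                (+-≈ _ _ (closedForm n) (toℚᵘ-/-≈ (+ (F ℕ.* Y n)) (X (suc n)) {{X-nonZero (suc n)}}))
    step : (numerator n ℤ.* + X (suc n) ℤ.+ + (F ℕ.* Y n) ℤ.* denominator n)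
             ℤ.* denominator (suc n)
           ≡ numerator (suc n) ℤ.* (denominator n ℤ.* + X (suc n))
    step = telescoping-step (+ F) (+ X n) (+ Y n) (+ A) (+ (1 + c)) (+ (3 + n))
             (X-suc n) (ℤP.pos-* (3 + n) (Y n)) (ℤP.pos-* F (Y n))

0<m<n⇒n∤n+m : ∀ {m n} → 0 < m → m < n → n ∤ n + m
0<m<n⇒n∤n+m {suc _} _ m<n n∣n+m = >⇒∤ m<n (∣m+n∣m⇒∣n n∣n+m ∣-refl)

sum-isZeroModP : ∀ {p t} → Prime p → 2 ≤ t → 2 + t ≤ p →
                 IsZeroModP p (sumFrom1 (term p t) (p ∸ 1))
sum-isZeroModP {suc p′} {suc (suc c)} p-prime (s≤s (s≤s z≤n)) 2+t≤p =
  ≈⇒isZeroModP p-prime p∤D p∣N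
    (≈-rescale _ {N′ = N} {D′ = + D} {{denominator-nonZero p′}} (closedForm p′)
               (cancel-F (+ F) N X≡ D≡))
  where
  open Telescoping (suc p′) c
  p = suc p′
  N = + 2 ℤ.* + X p′ ℤ.- + Y p′ ℤ.* + A
  D = (1 + c) ℕ.* (A ℕ.* (p + t))

  cancel-F : ∀ F N {X D} → X ≡ + (p + t) ℤ.* F → D ≡ + (1 + c) ℤ.* (+ A ℤ.* + (p + t)) →
             F ℤ.* N ℤ.* D ≡ N ℤ.* (+ (1 + c) ℤ.* (+ A ℤ.* X))
  cancel-F F N refl refl = identity F N (+ (p + t)) (+ (1 + c)) (+ A)
    where
    identity : ∀ F N P C A → F ℤ.* N ℤ.* (C ℤ.* (A ℤ.* P)) ≡ N ℤ.* (C ℤ.* (A ℤ.* (P ℤ.* F)))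
    identity = solve-∀

  X≡ : + X p′ ≡ + (p + t) ℤ.* + F
  X≡ = trans (cong (λ m → + (m !)) (ℕP.+-comm (p′ + t) 1)) (ℤP.pos-* (p + t) F)

  D≡ : + D ≡ + (1 + c) ℤ.* (+ A ℤ.* + (p + t))
  D≡ = trans (ℤP.pos-* (1 + c) (A ℕ.* (p + t))) (cong (+ (1 + c) ℤ.*_) (ℤP.pos-* A (p + t)))

  t<p : t < p
  t<p = ℕP.<⇒≤ 2+t≤p

  p∣N : p ∣ ∣ N ∣
  p∣N = ∣-linear (+ 2) (+ A)
    (m≤n⇒m∣n! (subst (p ≤_) (ℕP.+-comm 1 (p′ + t)) (s≤s (ℕP.m≤m+n p′ t))))
    (m≤n⇒m∣n! (ℕP.n≤1+n p))

  p∤D : p ∤ D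
  p∤D = prime∤* p-prime (>⇒∤ (ℕP.<-trans (ℕP.n<1+n (1 + c)) t<p))
       (prime∤* p-prime (prime∤! p-prime (subst (_< p) (ℕP.+-comm 1 t) 2+t≤p))
                        (0<m<n⇒n∤n+m (s≤s z≤n) t<p))

term-≈-integer : ∀ {p t r} → r < p ∸ 1 → ∃ λ k → toℚᵘ (term p t r) ≈ + k ÷ + 1
term-≈-integer {suc p′} {t} {r} r<p′ = integral (m≤n⇒m!∣n! r+t+1≤p′+t)
  where
  F = (p′ + t) !
  X = (r + t + 1) !
  X≢0 = (r + t + 1) !≢0

  r+t+1≤p′+t : r + t + 1 ≤ p′ + t
  r+t+1≤p′+t = subst (_≤ p′ + t) (ℕP.+-comm 1 (r + t)) (ℕP.+-monoˡ-≤ t r<p′)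

  rearrange : ∀ k X s → k ℕ.* X ℕ.* s ℕ.* 1 ≡ k ℕ.* s ℕ.* X
  rearrange = ℕ-Solver.solve-∀

  integral : X ∣ F → ∃ λ k → toℚᵘ (term (suc p′) t r) ≈ + k ÷ + 1
  integral (divides k F≡k*X) = k ℕ.* (suc r) ! ,
    ≈-rescaleℕ _ {{X≢0}} (toℚᵘ-/-≈ (+ (F ℕ.* (suc r) !)) X {{X≢0}}) (begin
      F ℕ.* (suc r) ! ℕ.* 1       ≡⟨ cong (λ m → m ℕ.* (suc r) ! ℕ.* 1) F≡k*X ⟩
      k ℕ.* X ℕ.* (suc r) ! ℕ.* 1 ≡⟨ rearrange k X ((suc r) !) ⟩
      k ℕ.* (suc r) ! ℕ.* X       ∎)

term-≈-last : ∀ p′ t → toℚᵘ (term (suc p′) t p′) ≈ + ((suc p′) !) ÷ + (suc p′ + t)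
term-≈-last p′ t = ≈-rescaleℕ _ {{X≢0}} (toℚᵘ-/-≈ (+ (F ℕ.* p !)) ((p′ + t + 1) !) {{X≢0}}) (begin
  F ℕ.* p ! ℕ.* (p + t)      ≡⟨ rearrange F (p !) (p + t) ⟩
  p ! ℕ.* ((p + t) ℕ.* F)    ≡⟨ cong (λ m → p ! ℕ.* m !) (ℕP.+-comm 1 (p′ + t)) ⟩
  p ! ℕ.* (p′ + t + 1) !     ∎)
  where
  p = suc p′
  F = (p′ + t) !
  X≢0 = (p′ + t + 1) !≢0
  rearrange : ∀ F P Q → F ℕ.* P ℕ.* Q ≡ P ℕ.* (Q ℕ.* F)
  rearrange = ℕ-Solver.solve-∀

term-denomPrimeTo : ∀ {p t r} → 1 < p → 0 < t → t < p → r ≤ p ∸ 1 → DenomPrimeTo p (term p t r)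
term-denomPrimeTo {suc p′} {t} 1<p 0<t t<p r≤p′ with ℕP.m≤n⇒m<n∨m≡n r≤p′
... | inj₁ r<p′ = ≈⇒denomPrimeTo (>⇒∤ 1<p) (proj₂ (term-≈-integer {suc p′} {t} r<p′))
... | inj₂ refl = ≈⇒denomPrimeTo (0<m<n⇒n∤n+m 0<t t<p) (term-≈-last p′ t)

tOf-1 : ∀ {p} → p % 3 ≡ 1 → tOf p ≡ (2 ℕ.* p + 1) / 3
tOf-1 p%3≡1 rewrite p%3≡1 = refl

tOf-2 : ∀ {p} → p % 3 ≡ 2 → tOf p ≡ (p + 1) / 3
tOf-2 p%3≡2 rewrite p%3≡2 = refl

[2[1+3q]+1]/3≡1+2q : ∀ q → (2 ℕ.* (1 + q ℕ.* 3) + 1) / 3 ≡ 1 + q ℕ.* 2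
[2[1+3q]+1]/3≡1+2q q = trans (cong (_/ 3) (distrib q)) (m*n/n≡m (1 + q ℕ.* 2) 3)
  where
  distrib : ∀ q → 2 ℕ.* (1 + q ℕ.* 3) + 1 ≡ (1 + q ℕ.* 2) ℕ.* 3
  distrib = ℕ-Solver.solve-∀

[2+3q+1]/3≡1+q : ∀ q → (2 + q ℕ.* 3 + 1) / 3 ≡ 1 + q
[2+3q+1]/3≡1+q q = trans (cong (_/ 3) (distrib q)) (m*n/n≡m (1 + q) 3)
  where
  distrib : ∀ q → 2 + q ℕ.* 3 + 1 ≡ (1 + q) ℕ.* 3
  distrib = ℕ-Solver.solve-∀

InRange : ℕ → ℕ → Set
InRange p t = 2 ≤ t × 2 + t ≤ p

tOf-bounds′ : ∀ {p} r q → Prime p → 3 < p → p % 3 ≡ r → p ≡ r + q ℕ.* 3 → InRange p (tOf p)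
tOf-bounds′ 0 q p-prime 3<p _ p≡q*3 with prime⇒irreducible p-prime (divides q p≡q*3)
... | inj₂ refl = ⊥-elim (ℕP.<-irrefl refl 3<p)
tOf-bounds′ 1 0 _ (s≤s ()) _ refl
tOf-bounds′ 1 1 p-prime _ _ refl = ⊥-elim (composite⇒¬prime composite[4] p-prime)
tOf-bounds′ {p} 1 (suc (suc q)) _ _ p%3≡1 refl =
  subst (InRange _) (sym (trans (tOf-1 {p} p%3≡1) ([2[1+3q]+1]/3≡1+2q (2 + q))))
    (s≤s (s≤s z≤n) , ℕP.+-monoʳ-≤ 7 (ℕP.*-monoʳ-≤ q (ℕP.n≤1+n 2)))
tOf-bounds′ 2 0 _ (s≤s (s≤s ())) _ refl
tOf-bounds′ {p} 2 (suc q) _ _ p%3≡2 refl =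
  subst (InRange _) (sym (trans (tOf-2 {p} p%3≡2) ([2+3q+1]/3≡1+q (1 + q))))
    (s≤s (s≤s z≤n) , ℕP.+-monoʳ-≤ 4 (ℕP.≤-trans (ℕP.m≤m*n q 3) (ℕP.n≤1+n _)))
tOf-bounds′ {p} (suc (suc (suc r))) _ _ _ p%3≡3+r _ =
  ⊥-elim (ℕP.<⇒≱ (m%n<n p 3) (subst (3 ≤_) (sym p%3≡3+r) (s≤s (s≤s (s≤s z≤n)))))

tOf-bounds : ∀ p → Prime p → 3 < p → InRange p (tOf p)
tOf-bounds p p-prime 3<p = tOf-bounds′ (p % 3) (p / 3) p-prime 3<p refl (m≡m%n+[m/n]*n p 3)

lemma4 : (p : ℕ) → Prime p → 3 < p →
    ((r : ℕ) → 1 ≤ r → r ≤ p ∸ 1 → DenomPrimeTo p (term p (tOf p) r))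
    × IsZeroModP p (sumFrom1 (term p (tOf p)) (p ∸ 1))
lemma4 p p-prime 3<p with tOf-bounds p p-prime 3<p
... | 2≤t , 2+t≤p =
    (λ r _ → term-denomPrimeTo 1<p (ℕP.≤-trans (s≤s z≤n) 2≤t) (ℕP.<⇒≤ 2+t≤p))
  , sum-isZeroModP p-prime 2≤t 2+t≤p
  where
  1<p : 1 < p
  1<p = ℕ.nonTrivial⇒n>1 p {{prime⇒nonTrivial p-prime}}
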